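{- Let $\Pi$ be a convergent (terminating and confluent) and complete polygraphic program. Then for every structure or function $2$-cell $f:u\Rightarrow v$ of $\Pi$, the map $[\![f]\!]:[\![u]\!]\to[\![v]\!]$ is total.
   Context: A 3-polygraph freely generates a strict $3$-category whose $k$-morphisms are $k$-paths, composed by $\star_j$ ($0\le j<k$); elementary $3$-paths (one $3$-cell) are rewriting steps on $2$-paths; termination, confluence and normal forms refer to this rewriting. A polygraphic program is a finite 3-polygraph with one $0$-cell $\ast$ whose $2$-cells split into structure $2$-cells $\tau_{\xi,\zeta}:\xi\zeta\Rightarrow\zeta\xi$, $\delta_\xi:\xi\Rightarrow\xi\xi$, $\epsilon_\xi:\xi\Rightarrow\ast$ (for $1$-cells $\xi,\zeta$), constructor $2$-cells (target a single $1$-cell) and function $2$-cells, and whose $3$-cells are structure $3$-cells (for each constructor $c:u\Rightarrow\xi$ and $1$-cell $\zeta$: $(c\star_0\zeta)\star_1\tau_{\xi,\zeta}\Rrightarrow\tau_{u,\zeta}\star_1(\zeta\star_0c)$, $(\zeta\star_0c)\star_1\tau_{\zeta,\xi}\Rrightarrow\tau_{\zeta,u}\star_1(c\star_0\zeta)$, $c\star_1\delta_\xi\Rrightarrow\delta_u\star_1(c\star_0c)$, $c\star_1\epsilon_\xi\Rrightarrow\epsilon_u$, with $\tau_{u,\zeta},\tau_{\zeta,u},\delta_u,\epsilon_u$ the structure $2$-paths built inductively from structure $2$-cells) and computation $3$-cells whose $2$-source has the form $t\star_1f$ with $t$ built from constructors only and $f$ a function $2$-cell. A value of type $u$ is a $2$-path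 $\ast\Rightarrow u$ built only from constructor $2$-cells; $[\![u]\!]$ is their set. For a $2$-path $f:u\Rightarrow v$, $[\![f]\!]$ is the partial map $[\![u]\!]\to[\![v]\!]$ sending $t$ to $t'$ when $t\star_1f$ has a unique normal form $t'$ that is a value, undefined otherwise. The program is complete if every $2$-path $t\star_1f$ with $t$ a value and $f$ a function $2$-cell is reducible. -}

module Defs where

open import Data.Nat using (ℕ)
open import Data.Fin using (Fin)
open import Data.List using (List; []; _∷_; _++_; map; [_])
open import Data.List.Relation.Unary.All using (All)
open import Data.Product using (Σ; ∃; _×_; _,_)
open import Data.Sum using (_⊎_)
open import Data.Empty using (⊥)
open import Data.Unit using (⊤)
open import Relation.Nullary using (¬_)
open import Relation.Binary.PropositionalEquality using (_≡_)
open import Relation.Binary.Construct.Closure.Equivalence using (EqClosure)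
open import Relation.Binary.Construct.Closure.ReflexiveTransitive using (Star)
open import Induction.WellFounded using (Acc)

-- One 0-cell; the 1-cells are  Fin n₁ ; 1-paths are words  List (Fin n₁)
-- (the empty word is the identity of the 0-cell ∗).

data Gen2 (n₁ nC nF : ℕ) : Set where
  τ   : Fin n₁ → Fin n₁ → Gen2 n₁ nC nF
  δ   : Fin n₁ → Gen2 n₁ nC nF
  ε   : Fin n₁ → Gen2 n₁ nC nF
  con : Fin nC → Gen2 n₁ nC nF
  fun : Fin nF → Gen2 n₁ nC nF

record Step (n₁ nC nF : ℕ) : Set where
  constructor step
  field
    left  : List (Fin n₁)
    gen   : Gen2 n₁ nC nF
    right : List (Fin n₁)

-- A (raw) 2-path: 1-source, 1-target and a sequence of whiskered
-- generators composed with ⋆₁ (validity is a separate predicate).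
-- 2-paths of the free 2-category are the valid ones, up to the
-- exchange relation _≈_ defined below.
record Path2 (n₁ nC nF : ℕ) : Set where
  constructor mkP
  field
    src   : List (Fin n₁)
    tgt   : List (Fin n₁)
    steps : List (Step n₁ nC nF)
open Path2 public

record Shape (n₁ nC nF : ℕ) : Set where
  field
    conSrc : Fin nC → List (Fin n₁)
    conTgt : Fin nC → Fin n₁
    funSrc : Fin nF → List (Fin n₁)
    funTgt : Fin nF → List (Fin n₁)

  gsrc : Gen2 n₁ nC nF → List (Fin n₁)
  gsrc (τ ξ ζ) = ξ ∷ ζ ∷ []
  gsrc (δ ξ)   = [ ξ ]
  gsrc (ε ξ)   = [ ξ ]
  gsrc (con c) = conSrc c
  gsrc (fun f) = funSrc f

  gtgt : Gen2 n₁ nC nF → List (Fin n₁)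
  gtgt (τ ξ ζ) = ζ ∷ ξ ∷ []
  gtgt (δ ξ)   = ξ ∷ ξ ∷ []
  gtgt (ε ξ)   = []
  gtgt (con c) = [ conTgt c ]
  gtgt (fun f) = funTgt f

  ssrc : Step n₁ nC nF → List (Fin n₁)
  ssrc (step l g r) = l ++ gsrc g ++ r

  stgt : Step n₁ nC nF → List (Fin n₁)
  stgt (step l g r) = l ++ gtgt g ++ r

  ValidChain : List (Fin n₁) → List (Step n₁ nC nF) → List (Fin n₁) → Set
  ValidChain u []       v = u ≡ v
  ValidChain u (s ∷ ss) v = (u ≡ ssrc s) × ValidChain (stgt s) ss v

  Valid : Path2 n₁ nC nF → Set
  Valid p = ValidChain (src p) (steps p) (tgt p)

  gen2 : Gen2 n₁ nC nF → Path2 n₁ nC nF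
  gen2 g = mkP (gsrc g) (gtgt g) [ step [] g [] ]

  idP : List (Fin n₁) → Path2 n₁ nC nF
  idP u = mkP u u []

  whiskS : List (Fin n₁) → List (Fin n₁) → Step n₁ nC nF → Step n₁ nC nF
  whiskS w w' (step l g r) = step (w ++ l) g (r ++ w')

  whisk : List (Fin n₁) → Path2 n₁ nC nF → List (Fin n₁) → Path2 n₁ nC nF
  whisk w p w' = mkP (w ++ src p ++ w') (w ++ tgt p ++ w') (map (whiskS w w') (steps p))

  infixl 5 _⋆₁_
  infixl 6 _⋆₀_

  _⋆₁_ : Path2 n₁ nC nF → Path2 n₁ nC nF → Path2 n₁ nC nF
  p ⋆₁ q = mkP (src p) (tgt q) (steps p ++ steps q)

  _⋆₀_ : Path2 n₁ nC nF → Path2 n₁ nC nF → Path2 n₁ nC nF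
  p ⋆₀ q = whisk [] p (src q) ⋆₁ whisk (tgt p) q []

  tauL : List (Fin n₁) → Fin n₁ → Path2 n₁ nC nF
  tauL []      ζ = idP [ ζ ]
  tauL (ξ ∷ u) ζ = whisk [ ξ ] (tauL u ζ) [] ⋆₁ whisk [] (gen2 (τ ξ ζ)) u

  tauR : Fin n₁ → List (Fin n₁) → Path2 n₁ nC nF
  tauR ζ []      = idP [ ζ ]
  tauR ζ (ξ ∷ u) = whisk [] (gen2 (τ ζ ξ)) u ⋆₁ whisk [ ξ ] (tauR ζ u) []

  deltaP : List (Fin n₁) → Path2 n₁ nC nF
  deltaP []      = idP []
  deltaP (ξ ∷ u) = (gen2 (δ ξ) ⋆₀ deltaP u) ⋆₁ whisk [ ξ ] (tauR ξ u) u

  epsP : List (Fin n₁) → Path2 n₁ nC nF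
  epsP []      = idP []
  epsP (ξ ∷ u) = gen2 (ε ξ) ⋆₀ epsP u

  IsConGen : Gen2 n₁ nC nF → Set
  IsConGen (con c) = ⊤
  IsConGen _       = ⊥

  IsConStep : Step n₁ nC nF → Set
  IsConStep s = IsConGen (Step.gen s)

  ConstructorOnly : Path2 n₁ nC nF → Set
  ConstructorOnly p = All IsConStep (steps p)

-- The exchange (interchange) relation between sequences of whiskered
-- generators; its equivalence closure identifies two sequences iff they
-- denote the same 2-cell of the free 2-category.
module _ {n₁ nC nF : ℕ} (S : Shape n₁ nC nF) where
  open Shape S
  data Swap : List (Step n₁ nC nF) → List (Step n₁ nC nF) → Set where
    here  : ∀ w g₁ w₁ g₂ w' rest →
            Swap (step w g₁ (w₁ ++ gsrc g₂ ++ w') ∷ step (w ++ gtgt g₁ ++ w₁) g₂ w' ∷ rest)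
                 (step (w ++ gsrc g₁ ++ w₁) g₂ w' ∷ step w g₁ (w₁ ++ gtgt g₂ ++ w') ∷ rest)
    there : ∀ x {xs ys} → Swap xs ys → Swap (x ∷ xs) (x ∷ ys)

record Program : Set where
  field
    n₁ nC nF nR : ℕ
    shape : Shape n₁ nC nF
  open Shape shape public
  field
    compTerm      : Fin nR → Path2 n₁ nC nF
    compFun       : Fin nR → Fin nF
    compRhs       : Fin nR → Path2 n₁ nC nF
    compTermValid : ∀ r → Valid (compTerm r)
    compTermCon   : ∀ r → ConstructorOnly (compTerm r)
    compTermTgt   : ∀ r → tgt (compTerm r) ≡ funSrc (compFun r)
    compRhsValid  : ∀ r → Valid (compRhs r)
    compRhsSrc    : ∀ r → src (compRhs r) ≡ src (compTerm r)
    compRhsTgt    : ∀ r → tgt (compRhs r) ≡ funTgt (compFun r)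

module Semantics (Π : Program) where
  open Program Π public

  Gen : Set
  Gen = Gen2 n₁ nC nF

  P2 : Set
  P2 = Path2 n₁ nC nF

  data Cell3 : Set where
    swapL  : Fin nC → Fin n₁ → Cell3
    swapR  : Fin nC → Fin n₁ → Cell3
    dup    : Fin nC → Cell3
    erase  : Fin nC → Cell3
    comp   : Fin nR → Cell3

  lhs3 : Cell3 → P2
  lhs3 (swapL c ζ) = whisk [] (gen2 (con c)) [ ζ ] ⋆₁ gen2 (τ (conTgt c) ζ)
  lhs3 (swapR c ζ) = whisk [ ζ ] (gen2 (con c)) [] ⋆₁ gen2 (τ ζ (conTgt c))
  lhs3 (dup c)     = gen2 (con c) ⋆₁ gen2 (δ (conTgt c))
  lhs3 (erase c)   = gen2 (con c) ⋆₁ gen2 (ε (conTgt c))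
  lhs3 (comp r)    = compTerm r ⋆₁ gen2 (fun (compFun r))

  rhs3 : Cell3 → P2
  rhs3 (swapL c ζ) = tauL (conSrc c) ζ ⋆₁ whisk [ ζ ] (gen2 (con c)) []
  rhs3 (swapR c ζ) = tauR ζ (conSrc c) ⋆₁ whisk [] (gen2 (con c)) [ ζ ]
  rhs3 (dup c)     = deltaP (conSrc c) ⋆₁ (gen2 (con c) ⋆₀ gen2 (con c))
  rhs3 (erase c)   = epsP (conSrc c)
  rhs3 (comp r)    = compRhs r

  _≈_ : P2 → P2 → Set
  p ≈ q = (src p ≡ src q) × (tgt p ≡ tgt q) × EqClosure (Swap shape) (steps p) (steps q)

  _⟶_ : P2 → P2 → Set
  p ⟶ q = Σ Cell3 λ α → Σ (List (Step n₁ nC nF)) λ a → Σ (List (Fin n₁)) λ w →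
          Σ (List (Fin n₁)) λ w' → Σ (List (Step n₁ nC nF)) λ b →
            (src p ≡ src q) × (tgt p ≡ tgt q)
          × EqClosure (Swap shape) (steps p) (a ++ map (whiskS w w') (steps (lhs3 α)) ++ b)
          × EqClosure (Swap shape) (steps q) (a ++ map (whiskS w w') (steps (rhs3 α)) ++ b)

  _⟶*_ : P2 → P2 → Set
  _⟶*_ = Star (λ p q → (p ≈ q) ⊎ (p ⟶ q))

  NormalForm : P2 → Set
  NormalForm q = ∀ r → ¬ (q ⟶ r)

  Terminating : Set
  Terminating = ∀ p → Valid p → Acc (λ q p' → p' ⟶ q) p

  Confluent : Set
  Confluent = ∀ p q r → Valid p → p ⟶* q → p ⟶* r → ∃ λ s → (q ⟶* s) × (r ⟶* s)

  IsValue : List (Fin n₁) → P2 → Set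
  IsValue u t = Valid t × (src t ≡ []) × (tgt t ≡ u) × ConstructorOnly t

  Complete : Set
  Complete = ∀ (f : Fin nF) (t : P2) → IsValue (funSrc f) t → ∃ λ r → (t ⋆₁ gen2 (fun f)) ⟶ r

  UniqueNF : P2 → P2 → Set
  UniqueNF p t' = (p ⟶* t') × NormalForm t' × (∀ q → p ⟶* q → NormalForm q → q ≈ t')

  DefinedAt : P2 → P2 → Set
  DefinedAt f t = ∃ λ t' → UniqueNF (t ⋆₁ f) t' × IsValue (tgt f) t'

  Total : P2 → Set
  Total f = ∀ t → IsValue (src f) t → DefinedAt f t

  data StructOrFun : Gen → Set where
    isτ   : ∀ ξ ζ → StructOrFun (τ ξ ζ)
    isδ   : ∀ ξ → StructOrFun (δ ξ)
    isε   : ∀ ξ → StructOrFun (ε ξ)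
    isfun : ∀ f → StructOrFun (fun f)

-- By termination t ⋆₁ f has a normal form, and by confluence every normal
-- form of t ⋆₁ f is equal to it, so it suffices that the normal forms of
-- valid 2-paths out of ∗ are exactly the values.  Values are normal, since
-- the source of every 3-cell contains a structure or function cell.
-- Conversely, let g be the first such cell of a valid 2-path out of ∗.  The
-- constructor cells before g form a forest, which the exchange law
-- rearranges so that the value producing the inputs of g comes last, right
-- before g.  If g is a structure cell, the last cell of that value is a
-- constructor plugged into g, and the two form the source of a structure
-- 3-cell; if g is a function cell, completeness gives a redex in that value
-- followed by g.

module Submission where

open import Defs
open import Data.Nat using (ℕ)
open import Data.Fin using (Fin)
open import Data.List using (List; []; _∷_; _++_; _∷ʳ_; map; [_])
open import Data.List.Properties using (++-assoc; ++-identityʳ; ++-monoid; map-++; map-∘; map-cong; ∷-injective)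
open import Data.List.Reverse using (Reverse; reverseView; []; _∶_∶ʳ_)
open import Data.List.Relation.Unary.All using (All; []; _∷_)
import Data.List.Relation.Unary.All.Properties as All
open import Data.Product using (Σ; ∃; ∃₂; _×_; _,_)
open import Data.Sum using (_⊎_; inj₁; inj₂)
open import Data.Empty using (⊥-elim)
open import Data.Unit using (tt)
open import Function using (_∘_; id)
open import Relation.Nullary using (¬_)
open import Relation.Binary.PropositionalEquality using (_≡_; refl; sym; trans; cong; cong₂; module ≡-Reasoning)
open import Relation.Binary.Construct.Closure.Equivalence using (EqClosure; gmap; symmetric)
open import Relation.Binary.Construct.Closure.ReflexiveTransitive using (_◅_; _◅◅_) renaming (ε to []*)
open import Relation.Binary.Construct.Closure.Symmetric using (fwd; bwd)
open import Induction.WellFounded using (Acc; acc)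
open import Tactic.MonoidSolver using (solve)

module _ {A : Set} where

  data Position₂ (a : List A) (x : A) (b L R : List A) : Set where
    inLeft  : ∀ L₂ → L ≡ a ++ x ∷ L₂ → b ≡ L₂ ++ R → Position₂ a x b L R
    inRight : ∀ R₁ → R ≡ R₁ ++ x ∷ b → a ≡ L ++ R₁ → Position₂ a x b L R

  position₂ : ∀ a x b L R → a ++ x ∷ b ≡ L ++ R → Position₂ a x b L R
  position₂ a x b [] R eq = inRight a (sym eq) refl
  position₂ [] x b (y ∷ L) R eq with ∷-injective eq
  ... | refl , eq′ = inLeft L refl eq′
  position₂ (a₀ ∷ a) x b (y ∷ L) R eq with ∷-injective eq
  ... | refl , eq′ with position₂ a x b L R eq′
  ...   | inLeft L₂ refl eqb = inLeft L₂ refl eqb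
  ...   | inRight R₁ eqR refl = inRight R₁ eqR refl

  data Position₃ (a : List A) (x : A) (b L M R : List A) : Set where
    inLeft   : ∀ L₂ → L ≡ a ++ x ∷ L₂ → b ≡ L₂ ++ M ++ R → Position₃ a x b L M R
    inMiddle : ∀ M₁ M₂ → M ≡ M₁ ++ x ∷ M₂ → a ≡ L ++ M₁ → b ≡ M₂ ++ R → Position₃ a x b L M R
    inRight  : ∀ R₁ → R ≡ R₁ ++ x ∷ b → a ≡ L ++ M ++ R₁ → Position₃ a x b L M R

  position₃ : ∀ a x b L M R → a ++ x ∷ b ≡ L ++ M ++ R → Position₃ a x b L M R
  position₃ a x b L M R eq with position₂ a x b L (M ++ R) eq
  ... | inLeft L₂ eqL eqb = inLeft L₂ eqL eqb
  ... | inRight Q₁ eqQ refl with position₂ Q₁ x b M R (sym eqQ)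
  ...   | inLeft M₂ eqM eqb = inMiddle Q₁ M₂ eqM refl eqb
  ...   | inRight R₁ eqR refl = inRight R₁ eqR refl

  singleton-split : ∀ (a : List A) x b y → a ++ x ∷ b ≡ [ y ] → a ≡ [] × b ≡ [] × x ≡ y
  singleton-split []          x []      y refl = refl , refl , refl
  singleton-split []          x (_ ∷ _) y ()
  singleton-split (_ ∷ [])    x b       y ()
  singleton-split (_ ∷ _ ∷ _) x b       y ()

module Chains {n₁ nC nF : ℕ} (S : Shape n₁ nC nF) where
  open Shape S

  Word : Set
  Word = List (Fin n₁)

  Steps : Set
  Steps = List (Step n₁ nC nF)

  assoc₄ : ∀ (a b c d : Word) → (a ++ b ++ c) ++ d ≡ a ++ b ++ c ++ d
  assoc₄ _ _ _ _ = solve (++-monoid (Fin n₁))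

  whisk-assoc : ∀ (w w′ l a r : Word) → w ++ (l ++ a ++ r) ++ w′ ≡ (w ++ l) ++ a ++ (r ++ w′)
  whisk-assoc _ _ _ _ _ = solve (++-monoid (Fin n₁))

  whiskS-whiskS : ∀ l r w w′ s → whiskS l r (whiskS w w′ s) ≡ whiskS (l ++ w) (w′ ++ r) s
  whiskS-whiskS l r w w′ (step a g b) =
    cong₂ (λ x y → step x g y) (sym (++-assoc l w a)) (++-assoc b w′ r)

  whiskS-unit : ∀ l g r → whiskS l r (step [] g []) ≡ step l g r
  whiskS-unit l g r = cong (λ x → step x g r) (++-identityʳ l)

  -- Validity of chains

  chain-resp : ∀ {u u′ v v′} xs → u ≡ u′ → v ≡ v′ → ValidChain u xs v → ValidChain u′ xs v′
  chain-resp xs refl refl h = h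

  chain-++ : ∀ {u m v} xs {ys} → ValidChain u xs m → ValidChain m ys v → ValidChain u (xs ++ ys) v
  chain-++ []       refl    h′ = h′
  chain-++ (_ ∷ xs) (e , h) h′ = e , chain-++ xs h h′

  chain-split : ∀ {u v} xs {ys} → ValidChain u (xs ++ ys) v → ∃ λ m → ValidChain u xs m × ValidChain m ys v
  chain-split []       h       = _ , refl , h
  chain-split (_ ∷ xs) (e , h) with chain-split xs h
  ... | m , h₁ , h₂ = m , (e , h₁) , h₂

  chain-before : ∀ {u v} cs {l g r rest} → ValidChain u (cs ++ step l g r ∷ rest) v → ValidChain u cs (l ++ gsrc g ++ r)
  chain-before cs h with chain-split cs h
  ... | _ , hcs , (refl , _) = hcs

  chain-target-unique : ∀ {u v v′} xs → ValidChain u xs v → ValidChain u xs v′ → v ≡ v′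
  chain-target-unique []       refl    refl     = refl
  chain-target-unique (_ ∷ xs) (_ , h) (_ , h′) = chain-target-unique xs h h′

  chain-source-unique : ∀ s xs {u u′ v v′} → ValidChain u (s ∷ xs) v → ValidChain u′ (s ∷ xs) v′ → u ≡ u′
  chain-source-unique _ _ (e , _) (e′ , _) = trans e (sym e′)

  chain-replace : ∀ {X Y} s xs ys a b {u v} → ValidChain X (s ∷ xs) Y → ValidChain X ys Y →
                  ValidChain u (a ++ (s ∷ xs) ++ b) v → ValidChain u (a ++ ys ++ b) v
  chain-replace {X} {Y} s xs ys a b old new h with chain-split a h
  ... | m₁ , ha , h′ with chain-split (s ∷ xs) h′
  ... | m₂ , hold , hb = chain-++ a ha (chain-++ ys (chain-resp ys (sym m₁≡X) (sym m₂≡Y) new) hb)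
    where
    m₁≡X : m₁ ≡ X
    m₁≡X = chain-source-unique s xs hold old
    m₂≡Y : m₂ ≡ Y
    m₂≡Y = chain-target-unique (s ∷ xs) (chain-resp (s ∷ xs) m₁≡X refl hold) old

  chain-whisk : ∀ w w′ {u v} xs → ValidChain u xs v →
                ValidChain (w ++ u ++ w′) (map (whiskS w w′) xs) (w ++ v ++ w′)
  chain-whisk w w′ []                refl       = refl
  chain-whisk w w′ (step l g r ∷ xs) (refl , h) =
    whisk-assoc w w′ l (gsrc g) r ,
    chain-resp _ (whisk-assoc w w′ l (gtgt g) r) refl (chain-whisk w w′ xs h)

  chain-whiskˡ : ∀ w {u v} xs → ValidChain u xs v → ValidChain (w ++ u) (map (whiskS w []) xs) (w ++ v)
  chain-whiskˡ w xs h =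
    chain-resp _ (cong (w ++_) (++-identityʳ _)) (cong (w ++_) (++-identityʳ _)) (chain-whisk w [] xs h)

  gen2-valid : ∀ g → Valid (gen2 g)
  gen2-valid g = sym (++-identityʳ _) , ++-identityʳ _

  ⋆₁-valid : ∀ {p q} → Valid p → Valid q → tgt p ≡ src q → Valid (p ⋆₁ q)
  ⋆₁-valid {p} {q} Vp Vq e = chain-++ (steps p) Vp (chain-resp (steps q) (sym e) refl Vq)

  -- The exchange law

  infix 4 _~_
  _~_ : Steps → Steps → Set
  _~_ = EqClosure (Swap S)

  ~-sym : ∀ {xs ys} → xs ~ ys → ys ~ xs
  ~-sym = symmetric (Swap S)

  ≡⇒~ : ∀ {xs ys} → xs ≡ ys → xs ~ ys
  ≡⇒~ refl = []*

  ~-transport : ∀ (P : Steps → Set) → (∀ {xs ys} → Swap S xs ys → P xs → P ys) →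
                (∀ {xs ys} → Swap S xs ys → P ys → P xs) → ∀ {xs ys} → xs ~ ys → P xs → P ys
  ~-transport P forth back []*          = id
  ~-transport P forth back (fwd s ◅ ss) = ~-transport P forth back ss ∘ forth s
  ~-transport P forth back (bwd s ◅ ss) = ~-transport P forth back ss ∘ back s

  chain-resp-~ : ∀ {u v xs ys} → xs ~ ys → ValidChain u xs v → ValidChain u ys v
  chain-resp-~ {u} {v} = ~-transport (λ xs → ValidChain u xs v) forth back
    where
    forth : ∀ {x y xs ys} → Swap S xs ys → ValidChain x xs y → ValidChain x ys y
    forth (here w g₁ w₁ g₂ w′ rest) (e , _ , h) =
      trans e (sym (assoc₄ w (gsrc g₁) w₁ (gsrc g₂ ++ w′))) , assoc₄ w (gsrc g₁) w₁ (gtgt g₂ ++ w′) ,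
      chain-resp rest (assoc₄ w (gtgt g₁) w₁ (gtgt g₂ ++ w′)) refl h
    forth (there x s) (e , h) = e , forth s h

    back : ∀ {x y xs ys} → Swap S xs ys → ValidChain x ys y → ValidChain x xs y
    back (here w g₁ w₁ g₂ w′ rest) (e , _ , h) =
      trans e (assoc₄ w (gsrc g₁) w₁ (gsrc g₂ ++ w′)) , sym (assoc₄ w (gtgt g₁) w₁ (gsrc g₂ ++ w′)) ,
      chain-resp rest (sym (assoc₄ w (gtgt g₁) w₁ (gtgt g₂ ++ w′))) refl h
    back (there x s) (e , h) = e , back s h

  constructorOnly-resp-~ : ∀ {xs ys} → xs ~ ys → All IsConStep xs → All IsConStep ys
  constructorOnly-resp-~ = ~-transport (All IsConStep) forth back
    where
    forth : ∀ {xs ys} → Swap S xs ys → All IsConStep xs → All IsConStep ys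
    forth (here _ _ _ _ _ _) (p ∷ q ∷ ps) = q ∷ p ∷ ps
    forth (there _ s)        (p ∷ ps)     = p ∷ forth s ps

    back : ∀ {xs ys} → Swap S xs ys → All IsConStep ys → All IsConStep xs
    back (here _ _ _ _ _ _) (p ∷ q ∷ ps) = q ∷ p ∷ ps
    back (there _ s)        (p ∷ ps)     = p ∷ back s ps

  exchange : ∀ w g₁ w₁ g₂ w′ rest {x₁ x₂ y₁ y₂} →
             x₁ ≡ w₁ ++ gsrc g₂ ++ w′ → x₂ ≡ w ++ gtgt g₁ ++ w₁ →
             y₁ ≡ w ++ gsrc g₁ ++ w₁ → y₂ ≡ w₁ ++ gtgt g₂ ++ w′ →
             Swap S (step w g₁ x₁ ∷ step x₂ g₂ w′ ∷ rest) (step y₁ g₂ w′ ∷ step w g₁ y₂ ∷ rest)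
  exchange w g₁ w₁ g₂ w′ rest refl refl refl refl = here w g₁ w₁ g₂ w′ rest

  ~-++⁺ˡ : ∀ P {xs ys} → xs ~ ys → P ++ xs ~ P ++ ys
  ~-++⁺ˡ P = gmap (P ++_) (prefix P)
    where
    prefix : ∀ P {xs ys} → Swap S xs ys → Swap S (P ++ xs) (P ++ ys)
    prefix []      s = s
    prefix (x ∷ P) s = there x (prefix P s)

  ~-++⁺ʳ : ∀ Q {xs ys} → xs ~ ys → xs ++ Q ~ ys ++ Q
  ~-++⁺ʳ Q = gmap (_++ Q) suffix
    where
    suffix : ∀ {xs ys} → Swap S xs ys → Swap S (xs ++ Q) (ys ++ Q)
    suffix (here w g₁ w₁ g₂ w′ rest) = here w g₁ w₁ g₂ w′ (rest ++ Q)
    suffix (there x s)               = there x (suffix s)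

  ~-whisk : ∀ L R {xs ys} → xs ~ ys → map (whiskS L R) xs ~ map (whiskS L R) ys
  ~-whisk L R = gmap (map (whiskS L R)) whisked
    where
    whisked : ∀ {xs ys} → Swap S xs ys → Swap S (map (whiskS L R) xs) (map (whiskS L R) ys)
    whisked (here w g₁ w₁ g₂ w′ rest) =
      exchange (L ++ w) g₁ w₁ g₂ (w′ ++ R) (map (whiskS L R) rest)
        (assoc₄ w₁ (gsrc g₂) w′ R) (sym (++-assoc L w (gtgt g₁ ++ w₁)))
        (sym (++-assoc L w (gsrc g₁ ++ w₁))) (assoc₄ w₁ (gtgt g₂) w′ R)
    whisked (there x s) = there _ (whisked s)

  interchangeˡ : ∀ L₁ g L₂ R {M₀ M₁} B → ValidChain M₀ B M₁ →
    map (whiskS (L₁ ++ gsrc g ++ L₂) R) B ++ [ step L₁ g (L₂ ++ M₁ ++ R) ]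
      ~ step L₁ g (L₂ ++ M₀ ++ R) ∷ map (whiskS (L₁ ++ gtgt g ++ L₂) R) B
  interchangeˡ L₁ g L₂ R []                refl       = []*
  interchangeˡ L₁ g L₂ R (step l h r ∷ B) (refl , hB) =
    ~-++⁺ˡ [ step ((L₁ ++ gsrc g ++ L₂) ++ l) h (r ++ R) ] (interchangeˡ L₁ g L₂ R B hB)
    ◅◅ bwd (exchange L₁ g (L₂ ++ l) h (r ++ R) (map (whiskS (L₁ ++ gtgt g ++ L₂) R) B)
             (whisk-assoc L₂ R l (gsrc h) r) (assoc₄ L₁ (gtgt g) L₂ l)
             (assoc₄ L₁ (gsrc g) L₂ l) (whisk-assoc L₂ R l (gtgt h) r)) ◅ []*

  interchangeʳ : ∀ L R₁ g R₂ {M₀ M₁} B → ValidChain M₀ B M₁ →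
    map (whiskS L (R₁ ++ gsrc g ++ R₂)) B ++ [ step (L ++ M₁ ++ R₁) g R₂ ]
      ~ step (L ++ M₀ ++ R₁) g R₂ ∷ map (whiskS L (R₁ ++ gtgt g ++ R₂)) B
  interchangeʳ L R₁ g R₂ []                refl       = []*
  interchangeʳ L R₁ g R₂ (step l h r ∷ B) (refl , hB) =
    ~-++⁺ˡ [ step (L ++ l) h (r ++ R₁ ++ gsrc g ++ R₂) ] (interchangeʳ L R₁ g R₂ B hB)
    ◅◅ fwd (exchange (L ++ l) h (r ++ R₁) g R₂ (map (whiskS L (R₁ ++ gtgt g ++ R₂)) B)
             (sym (++-assoc r R₁ (gsrc g ++ R₂))) (whisk-assoc L R₁ l (gtgt h) r)
             (whisk-assoc L R₁ l (gsrc h) r) (sym (++-assoc r R₁ (gtgt g ++ R₂)))) ◅ []*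

  -- Structure 2-paths

  tauL-chain : ∀ u ζ → ValidChain (u ++ [ ζ ]) (steps (tauL u ζ)) (ζ ∷ u)
  tauL-chain []      ζ = refl
  tauL-chain (ξ ∷ u) ζ = chain-++ (map (whiskS [ ξ ] []) (steps (tauL u ζ)))
    (chain-whiskˡ [ ξ ] _ (tauL-chain u ζ)) (refl , refl)

  tauR-chain : ∀ ζ u → ValidChain (ζ ∷ u) (steps (tauR ζ u)) (u ++ [ ζ ])
  tauR-chain ζ []      = refl
  tauR-chain ζ (ξ ∷ u) = chain-++ [ step [] (τ ζ ξ) u ] (refl , refl)
    (chain-whiskˡ [ ξ ] _ (tauR-chain ζ u))

  deltaP-src : ∀ u → src (deltaP u) ≡ u
  deltaP-src []      = refl
  deltaP-src (ξ ∷ u) = cong (ξ ∷_) (deltaP-src u)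

  deltaP-chain : ∀ u → ValidChain u (steps (deltaP u)) (u ++ u)
  deltaP-chain []      = refl
  deltaP-chain (ξ ∷ u) =
    chain-++ (step [] (δ ξ) (src (deltaP u)) ∷ map (whiskS (ξ ∷ ξ ∷ []) []) (steps (deltaP u)))
      ( cong (ξ ∷_) (sym (deltaP-src u))
      , chain-resp _ (cong (λ v → ξ ∷ ξ ∷ v) (sym (deltaP-src u))) refl
          (chain-whiskˡ (ξ ∷ ξ ∷ []) _ (deltaP-chain u)))
      (chain-resp _ refl (cong (ξ ∷_) (++-assoc u [ ξ ] u)) (chain-whisk [ ξ ] u _ (tauR-chain ξ u)))

  epsP-src : ∀ u → src (epsP u) ≡ u
  epsP-src []      = refl
  epsP-src (ξ ∷ u) = cong (ξ ∷_) (epsP-src u)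

  epsP-chain : ∀ u → ValidChain u (steps (epsP u)) []
  epsP-chain []      = refl
  epsP-chain (ξ ∷ u) =
    cong (ξ ∷_) (sym (epsP-src u)) , chain-resp _ (sym (epsP-src u)) refl (chain-whiskˡ [] _ (epsP-chain u))

  -- Factorisation of constructor chains

  ValueChain : Word → Steps → Set
  ValueChain M B = ValidChain [] B M × All IsConStep B

  asConstructor : ∀ {g} → IsConGen g → ∃ λ c → g ≡ con c
  asConstructor {con c} _ = c , refl

  record Factorisation (cs : Steps) (L M R : Word) : Set where
    constructor factorisation
    field
      prefix      : Steps
      block       : Steps
      exchanged   : cs ~ prefix ++ map (whiskS L R) block
      block-value : ValueChain M block

  -- The new constructor either belongs to the block, and is appended to it,
  -- or lies beside it, and is moved in front of it by interchange.
  factorisation-∷ʳ : ∀ {xs} a c b L M R →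
    (∀ L M R → ValidChain [] xs (L ++ M ++ R) → Factorisation xs L M R) →
    Position₃ a (conTgt c) b L M R → ValidChain [] xs (a ++ conSrc c ++ b) →
    Factorisation (xs ∷ʳ step a (con c) b) L M R
  factorisation-∷ʳ {xs} a c b _ M R factor (inLeft L₂ refl refl) hxs
    with factor (a ++ conSrc c ++ L₂) M R (chain-resp xs refl (sym (assoc₄ a (conSrc c) L₂ (M ++ R))) hxs)
  ... | factorisation A B xs~ vB@(hB , _) =
    factorisation (A ++ [ step a (con c) (L₂ ++ R) ]) B
      (~-++⁺ʳ _ xs~ ◅◅ ≡⇒~ (++-assoc A _ _) ◅◅ ~-++⁺ˡ A (interchangeˡ a (con c) L₂ R B hB)
        ◅◅ ≡⇒~ (sym (++-assoc A _ _)))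
      vB
  factorisation-∷ʳ {xs} _ c _ L _ R factor (inMiddle M₁ M₂ refl refl refl) hxs
    with factor L (M₁ ++ conSrc c ++ M₂) R (chain-resp xs refl (sym (whisk-assoc L R M₁ (conSrc c) M₂)) hxs)
  ... | factorisation A B xs~ (hB , coB) =
    factorisation A (B ∷ʳ step M₁ (con c) M₂)
      (~-++⁺ʳ _ xs~ ◅◅ ≡⇒~ (trans (++-assoc A _ _) (cong (A ++_) (sym (map-++ (whiskS L R) B _)))))
      (chain-++ B hB (refl , refl) , All.∷ʳ⁺ coB tt)
  factorisation-∷ʳ {xs} _ c b L M _ factor (inRight R₁ refl refl) hxs
    with factor L M (R₁ ++ conSrc c ++ b) (chain-resp xs refl (assoc₄ L M R₁ (conSrc c ++ b)) hxs)
  ... | factorisation A B xs~ vB@(hB , _) =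
    factorisation (A ++ [ step (L ++ R₁) (con c) b ]) B
      (~-++⁺ʳ _ xs~ ◅◅ ≡⇒~ (++-assoc A _ _) ◅◅ ~-++⁺ˡ A (interchangeʳ L R₁ (con c) b B hB)
        ◅◅ ≡⇒~ (sym (++-assoc A _ _)))
      vB

  factorise : ∀ {cs} → Reverse cs → ∀ L M R → ValueChain (L ++ M ++ R) cs → Factorisation cs L M R
  factorise [] [] [] [] _ = factorisation [] [] []* (refl , [])
  factorise (xs ∶ rs ∶ʳ step a g b) L M R (h , co) with All.∷ʳ⁻ {xs = xs} co
  ... | coxs , isCon with asConstructor isCon
  ... | c , refl with chain-split xs h
  ... | _ , hxs , (refl , eq) =
    factorisation-∷ʳ a c b L M R (λ L M R h → factorise rs L M R (h , coxs)) (position₃ a (conTgt c) b L M R eq) hxs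

  last-constructor : ∀ {B} → Reverse B → ∀ ξ → ValueChain [ ξ ] B →
                     ∃₂ λ B′ c → B ≡ B′ ∷ʳ step [] (con c) [] × conTgt c ≡ ξ
  last-constructor (xs ∶ _ ∶ʳ step a g b) ξ (h , co) with All.∷ʳ⁻ {xs = xs} co
  ... | _ , isCon with asConstructor isCon
  ... | c , refl with chain-split xs h
  ... | _ , _ , (_ , eq) with singleton-split a (conTgt c) b ξ eq
  ... | refl , refl , conTgt≡ξ = xs , c , refl , conTgt≡ξ

module Rewriting (Π : Program) where
  open Semantics Π
  open Chains shape

  lhs-rhs-parallel : ∀ α → ∃₂ λ X Y → ValidChain X (steps (lhs3 α)) Y × ValidChain X (steps (rhs3 α)) Y
  lhs-rhs-parallel (swapL c ζ) = _ , _ , (refl , refl , refl) ,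
    chain-++ (steps (tauL (conSrc c) ζ)) (tauL-chain (conSrc c) ζ) (cong (ζ ∷_) (sym (++-identityʳ _)) , refl)
  lhs-rhs-parallel (swapR c ζ) = ζ ∷ conSrc c , _ , (cong (ζ ∷_) (sym (++-identityʳ _)) , refl , refl) ,
    chain-++ (steps (tauR ζ (conSrc c))) (tauR-chain ζ (conSrc c)) (refl , refl)
  lhs-rhs-parallel (dup c) = conSrc c , _ , (sym (++-identityʳ _) , refl , refl) ,
    chain-++ (steps (deltaP (conSrc c))) (deltaP-chain (conSrc c))
      (refl , cong (conTgt c ∷_) (sym (++-identityʳ _)) , refl)
  lhs-rhs-parallel (erase c) = conSrc c , [] , (sym (++-identityʳ _) , refl , refl) , epsP-chain (conSrc c)
  lhs-rhs-parallel (comp r) = src (compTerm r) , funTgt (compFun r) ,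
    ⋆₁-valid (compTermValid r) (gen2-valid (fun (compFun r))) (compTermTgt r) ,
    chain-resp _ (compRhsSrc r) (compRhsTgt r) (compRhsValid r)

  lhs-not-constructorOnly : ∀ α → ¬ All IsConStep (steps (lhs3 α))
  lhs-not-constructorOnly (swapL _ _) (_ ∷ () ∷ _)
  lhs-not-constructorOnly (swapR _ _) (_ ∷ () ∷ _)
  lhs-not-constructorOnly (dup _)     (_ ∷ () ∷ _)
  lhs-not-constructorOnly (erase _)   (_ ∷ () ∷ _)
  lhs-not-constructorOnly (comp r) co with All.++⁻ʳ (steps (compTerm r)) co
  ... | () ∷ _

  lhs-nonempty : ∀ α → ∃₂ λ s xs → steps (lhs3 α) ≡ s ∷ xs
  lhs-nonempty α with steps (lhs3 α) | lhs-not-constructorOnly α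
  ... | []     | notCon = ⊥-elim (notCon [])
  ... | s ∷ xs | _      = s , xs , refl

  redex-replace : ∀ α a w w′ b {u v} → ValidChain u (a ++ map (whiskS w w′) (steps (lhs3 α)) ++ b) v →
                  ValidChain u (a ++ map (whiskS w w′) (steps (rhs3 α)) ++ b) v
  redex-replace α a w w′ b with steps (lhs3 α) | lhs-nonempty α | lhs-rhs-parallel α
  ... | _ | s , xs , refl | X , Y , old , new =
    chain-replace (whiskS w w′ s) (map (whiskS w w′) xs) (map (whiskS w w′) (steps (rhs3 α))) a b
      (chain-whisk w w′ (s ∷ xs) old) (chain-whisk w w′ (steps (rhs3 α)) new)

  ⟶-preserves-Valid : ∀ {p q} → p ⟶ q → Valid p → Valid q
  ⟶-preserves-Valid {p} {q} (α , a , w , w′ , b , src≡ , tgt≡ , p~ , q~) V =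
    chain-resp (steps q) src≡ tgt≡ (chain-resp-~ (~-sym q~) (redex-replace α a w w′ b (chain-resp-~ p~ V)))

  constructorOnly-normal : ∀ q → ConstructorOnly q → NormalForm q
  constructorOnly-normal q co _ (α , a , w , w′ , b , _ , _ , q~ , _) =
    lhs-not-constructorOnly α (All.map⁻ (All.++⁻ˡ _ (All.++⁻ʳ a (constructorOnly-resp-~ q~ co))))

  Redex : Steps → Set
  Redex xs = Σ Cell3 λ α → Σ Steps λ a → Σ Word λ w → Σ Word λ w′ → Σ Steps λ b →
             xs ~ a ++ map (whiskS w w′) (steps (lhs3 α)) ++ b

  ⟶-redex : ∀ {p q} → p ⟶ q → Redex (steps p)
  ⟶-redex (α , a , w , w′ , b , _ , _ , p~ , _) = α , a , w , w′ , b , p~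

  redex-⟶ : ∀ q → Redex (steps q) → ∃ (q ⟶_)
  redex-⟶ q (α , a , w , w′ , b , q~) =
    mkP (src q) (tgt q) (a ++ map (whiskS w w′) (steps (rhs3 α)) ++ b) ,
    α , a , w , w′ , b , refl , refl , q~ , []*

  redex-resp : ∀ {xs ys} → xs ~ ys → Redex ys → Redex xs
  redex-resp xs~ys (α , a , w , w′ , b , ys~) = α , a , w , w′ , b , xs~ys ◅◅ ys~

  redex-in-context : ∀ A l r rest {xs} → Redex xs → Redex (A ++ map (whiskS l r) xs ++ rest)
  redex-in-context A l r rest (α , a , w , w′ , b , xs~) =
    α , A ++ map W a , l ++ w , w′ ++ r , map W b ++ rest ,
    ~-++⁺ˡ A (~-++⁺ʳ rest (~-whisk l r xs~)) ◅◅ ≡⇒~ reassociate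
    where
    open ≡-Reasoning
    W : Step n₁ nC nF → Step n₁ nC nF
    W = whiskS l r
    Y : Steps
    Y = steps (lhs3 α)
    reassociate : A ++ map W (a ++ map (whiskS w w′) Y ++ b) ++ rest
                ≡ (A ++ map W a) ++ map (whiskS (l ++ w) (w′ ++ r)) Y ++ map W b ++ rest
    reassociate = begin
      A ++ map W (a ++ map (whiskS w w′) Y ++ b) ++ rest
        ≡⟨ cong (λ z → A ++ z ++ rest) (trans (map-++ W a _) (cong (map W a ++_) (map-++ W _ b))) ⟩
      A ++ (map W a ++ map W (map (whiskS w w′) Y) ++ map W b) ++ rest
        ≡⟨ cong (λ z → A ++ (map W a ++ z ++ map W b) ++ rest)
                (trans (sym (map-∘ Y)) (map-cong (whiskS-whiskS l r w w′) Y)) ⟩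
      A ++ (map W a ++ map (whiskS (l ++ w) (w′ ++ r)) Y ++ map W b) ++ rest
        ≡⟨ solve (++-monoid (Step n₁ nC nF)) ⟩
      (A ++ map W a) ++ map (whiskS (l ++ w) (w′ ++ r)) Y ++ map W b ++ rest ∎

  -- Structural ξ ρ g: g is a structure 2-cell with source ξ ∷ ρ, and a
  -- constructor of type ξ followed by g is the source of a structure 3-cell
  -- (for τ, the one acting on the left input).
  data Structural : Fin n₁ → Word → Gen → Set where
    τ-structural : ∀ ξ ζ → Structural ξ [ ζ ] (τ ξ ζ)
    δ-structural : ∀ ξ → Structural ξ [] (δ ξ)
    ε-structural : ∀ ξ → Structural ξ [] (ε ξ)

  structural-src : ∀ {ξ ρ g} → Structural ξ ρ g → gsrc g ≡ ξ ∷ ρ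
  structural-src (τ-structural _ _) = refl
  structural-src (δ-structural _)   = refl
  structural-src (ε-structural _)   = refl

  structure-cell : ∀ c {ρ g} → Structural (conTgt c) ρ g →
                   Σ Cell3 λ α → steps (lhs3 α) ≡ step [] (con c) ρ ∷ step [] g [] ∷ []
  structure-cell c (τ-structural _ ζ) = swapL c ζ , refl
  structure-cell c (δ-structural _)   = dup c , refl
  structure-cell c (ε-structural _)   = erase c , refl

  data FirstNonConstructor : Steps → Set where
    none       : ∀ {xs} → All IsConStep xs → FirstNonConstructor xs
    structural : ∀ {ξ ρ g} cs l r rest → All IsConStep cs → Structural ξ ρ g →
                 FirstNonConstructor (cs ++ step l g r ∷ rest)
    function   : ∀ f cs l r rest → All IsConStep cs → FirstNonConstructor (cs ++ step l (fun f) r ∷ rest)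

  firstNonConstructor : ∀ xs → FirstNonConstructor xs
  firstNonConstructor []                        = none []
  firstNonConstructor (step l (τ ξ ζ) r ∷ rest) = structural [] l r rest [] (τ-structural ξ ζ)
  firstNonConstructor (step l (δ ξ) r ∷ rest)   = structural [] l r rest [] (δ-structural ξ)
  firstNonConstructor (step l (ε ξ) r ∷ rest)   = structural [] l r rest [] (ε-structural ξ)
  firstNonConstructor (step l (fun f) r ∷ rest) = function f [] l r rest []
  firstNonConstructor (s@(step _ (con _) _) ∷ xs) with firstNonConstructor xs
  ... | none co                      = none (tt ∷ co)
  ... | structural cs l r rest co st = structural (s ∷ cs) l r rest (tt ∷ co) st
  ... | function f cs l r rest co    = function f (s ∷ cs) l r rest (tt ∷ co)

  redex-at-structure-cell : ∀ {ξ ρ g} cs l r rest → Structural ξ ρ g →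
                            ValueChain (l ++ gsrc g ++ r) cs → Redex (cs ++ step l g r ∷ rest)
  redex-at-structure-cell {ξ} {ρ} {g} cs l r rest st (hcs , co)
    with factorise (reverseView cs) l [ ξ ] (ρ ++ r)
           (chain-resp cs refl (cong (λ v → l ++ v ++ r) (structural-src st)) hcs , co)
  ... | factorisation A B cs~ vB with last-constructor (reverseView B) ξ vB
  ... | B′ , c , refl , refl with structure-cell c st
  ... | α , lhs≡ =
    redex-resp (~-++⁺ʳ (step l g r ∷ rest) cs~)
      (α , A ++ map W B′ , l , r , rest , ≡⇒~ reassociate)
    where
    open ≡-Reasoning
    W : Step n₁ nC nF → Step n₁ nC nF
    W = whiskS l (ρ ++ r)
    reassociate : (A ++ map W (B′ ∷ʳ step [] (con c) [])) ++ step l g r ∷ rest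
                ≡ (A ++ map W B′) ++ map (whiskS l r) (steps (lhs3 α)) ++ rest
    reassociate = begin
      (A ++ map W (B′ ∷ʳ step [] (con c) [])) ++ step l g r ∷ rest
        ≡⟨ cong (λ z → (A ++ z) ++ step l g r ∷ rest) (map-++ W B′ _) ⟩
      (A ++ map W B′ ++ [ W (step [] (con c) []) ]) ++ step l g r ∷ rest
        ≡⟨ solve (++-monoid (Step n₁ nC nF)) ⟩
      (A ++ map W B′) ++ [ W (step [] (con c) []) ] ++ step l g r ∷ rest
        ≡⟨ cong (λ s → (A ++ map W B′) ++ W (step [] (con c) []) ∷ s ∷ rest) (sym (whiskS-unit l g r)) ⟩
      (A ++ map W B′) ++ map (whiskS l r) (step [] (con c) ρ ∷ step [] g [] ∷ []) ++ rest
        ≡⟨ cong (λ z → (A ++ map W B′) ++ map (whiskS l r) z ++ rest) (sym lhs≡) ⟩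
      (A ++ map W B′) ++ map (whiskS l r) (steps (lhs3 α)) ++ rest ∎

  redex-at-function-cell : Complete → ∀ f cs l r rest →
                           ValueChain (l ++ funSrc f ++ r) cs → Redex (cs ++ step l (fun f) r ∷ rest)
  redex-at-function-cell complete f cs l r rest vcs
    with factorise (reverseView cs) l (funSrc f) r vcs
  ... | factorisation A B cs~ (hB , coB) with complete f (mkP [] (funSrc f) B) (hB , refl , refl , coB)
  ... | _ , B·f⟶ =
    redex-resp (~-++⁺ʳ (step l (fun f) r ∷ rest) cs~ ◅◅ ≡⇒~ reassociate)
      (redex-in-context A l r rest (⟶-redex B·f⟶))
    where
    open ≡-Reasoning
    W : Step n₁ nC nF → Step n₁ nC nF
    W = whiskS l r
    reassociate : (A ++ map W B) ++ step l (fun f) r ∷ rest ≡ A ++ map W (B ∷ʳ step [] (fun f) []) ++ rest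
    reassociate = begin
      (A ++ map W B) ++ step l (fun f) r ∷ rest
        ≡⟨ cong (λ s → (A ++ map W B) ++ s ∷ rest) (sym (whiskS-unit l (fun f) r)) ⟩
      (A ++ map W B) ++ [ W (step [] (fun f) []) ] ++ rest
        ≡⟨ solve (++-monoid (Step n₁ nC nF)) ⟩
      A ++ (map W B ++ [ W (step [] (fun f) []) ]) ++ rest
        ≡⟨ cong (λ z → A ++ z ++ rest) (sym (map-++ W B _)) ⟩
      A ++ map W (B ∷ʳ step [] (fun f) []) ++ rest ∎

  progress : Complete → ∀ q → Valid q → src q ≡ [] → ConstructorOnly q ⊎ ∃ (q ⟶_)
  progress complete (mkP u v xs) V refl with firstNonConstructor xs
  ... | none co = inj₁ co
  ... | structural cs l r rest co st =
    inj₂ (redex-⟶ (mkP [] v _) (redex-at-structure-cell cs l r rest st (chain-before cs V , co)))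
  ... | function f cs l r rest co =
    inj₂ (redex-⟶ (mkP [] v _) (redex-at-function-cell complete f cs l r rest (chain-before cs V , co)))

  normalise : Complete → ∀ q → Acc (λ q p → p ⟶ q) q → Valid q → src q ≡ [] →
              ∃ λ t → q ⟶* t × IsValue (tgt q) t
  normalise complete q (acc rec) V src≡ with progress complete q V src≡
  ... | inj₁ co = q , []* , V , src≡ , refl , co
  ... | inj₂ (q′ , q⟶q′@(_ , _ , _ , _ , _ , src≡′ , tgt≡′ , _))
    with normalise complete q′ (rec q⟶q′) (⟶-preserves-Valid q⟶q′ V) (trans (sym src≡′) src≡)
  ... | t , q′⟶*t , Vt , src-t , tgt-t , co-t =
    t , inj₂ q⟶q′ ◅ q′⟶*t , Vt , src-t , trans tgt-t (sym tgt≡′) , co-t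

  ≈-refl : ∀ {p} → p ≈ p
  ≈-refl = refl , refl , []*

  ≈-sym : ∀ {p q} → p ≈ q → q ≈ p
  ≈-sym (s , t , e) = sym s , sym t , ~-sym e

  ≈-trans : ∀ {p q r} → p ≈ q → q ≈ r → p ≈ r
  ≈-trans (s , t , e) (s′ , t′ , e′) = trans s s′ , trans t t′ , e ◅◅ e′

  normalForm-resp-≈ : ∀ {p q} → p ≈ q → NormalForm p → NormalForm q
  normalForm-resp-≈ (s , t , e) nf r (α , a , w , w′ , b , src≡ , tgt≡ , q~ , r~) =
    nf r (α , a , w , w′ , b , trans s src≡ , trans t tgt≡ , e ◅◅ q~ , r~)

  normalForm-⟶* : ∀ {p q} → NormalForm p → p ⟶* q → p ≈ q
  normalForm-⟶* nf []*              = ≈-refl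
  normalForm-⟶* nf (inj₁ p≈ ◅ rest) = ≈-trans p≈ (normalForm-⟶* (normalForm-resp-≈ p≈ nf) rest)
  normalForm-⟶* nf (inj₂ p⟶ ◅ _)    = ⊥-elim (nf _ p⟶)

  unique-normal-form : Confluent → ∀ {p t} → Valid p → p ⟶* t → NormalForm t →
                       ∀ q → p ⟶* q → NormalForm q → q ≈ t
  unique-normal-form confluent {p} {t} V p⟶*t nf-t q p⟶*q nf-q with confluent p q t V p⟶*q p⟶*t
  ... | _ , q⟶*s , t⟶*s = ≈-trans (normalForm-⟶* nf-q q⟶*s) (≈-sym (normalForm-⟶* nf-t t⟶*s))

  valid-total : Terminating → Confluent → Complete → ∀ f → Valid f → Total f
  valid-total terminating confluent complete f Vf t (Vt , src≡ , tgt≡ , _) with ⋆₁-valid Vt Vf tgt≡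
  ... | V with normalise complete (t ⋆₁ f) (terminating _ V) V src≡
  ... | t′ , reduces , value@(_ , _ , _ , co) =
    t′ , (reduces , nf , unique-normal-form confluent V reduces nf) , value
    where
    nf : NormalForm t′
    nf = constructorOnly-normal t′ co

proposition1p26 : (Π : Program) → let open Semantics Π in
    Terminating → Confluent → Complete →
    ∀ (g : Gen) → StructOrFun g → Total (gen2 g)
proposition1p26 Π terminating confluent complete g _ =
  valid-total terminating confluent complete (gen2 g) (gen2-valid g)
  where
  open Semantics Π
  open Chains shape
  open Rewriting Π
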